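{- Let $H$ be a directed graph with at least two arcs. Then $$\frac{|E(H)|}{2} \le f(H) \le \min\{\gamma(H),\, b(H)\}.$$
   Context: Directed graphs have no loops or parallel arcs but may contain directed 2-cycles. $\gamma(H)$ is the maximum number of arcs in an acyclic subgraph of $H$; $b(H)$ is the maximum number of arcs in a bipartite subgraph of $H$ (a subgraph whose underlying vertex set splits into two parts with every arc joining the two parts). For a directed graph $L$, the blowup $B(L)$ replaces each vertex $v$ by a countably infinite independent set $I_v$ with all arcs from $I_a$ to $I_b$ whenever $(a,b)\in E(L)$. ${\rm disc}_H(L)$ is the minimum number of arcs that must be added to $B(L)$ to obtain a copy of $H$. $f(H,L)=\max\{|E(H)|(1-|E(L)|/|V(L)|^2),\,|E(H)|-{\rm disc}_H(L)\}$ and $f(H)=\inf_L f(H,L)$ over all directed graphs $L$ with at least one arc. -}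

module Defs where

open import Data.Nat using (ℕ; zero; suc; _≤_) renaming (_*_ to _*ℕ_)
open import Data.Bool using (Bool; true; false; if_then_else_; _∧_; not)
open import Data.Fin using (Fin)
open import Data.List using (map; allFin)
open import Data.Nat.ListAction using (sum)
open import Data.Product using (Σ; _×_; _,_; ∃; ∃-syntax; proj₁)
open import Data.Integer using (+_)
open import Data.Rational using (ℚ; _/_; _*_; _-_; _⊔_; 1ℚ)
open import Relation.Binary.PropositionalEquality using (_≡_; _≢_)
open import Relation.Nullary using (¬_)
open import Function.Definitions using (Injective)

-- No loops (loopless); parallel arcs are impossible since
-- arcs form a relation; directed 2-cycles are allowed.
record Digraph : Set where
  field
    size     : ℕ
    arc      : Fin size → Fin size → Bool
    loopless : ∀ i → arc i i ≡ false
open Digraph public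

count : (n : ℕ) → (Fin n → Fin n → Bool) → ℕ
count n R = sum (map (λ i → sum (map (λ j → if R i j then 1 else 0) (allFin n))) (allFin n))

arcCount : Digraph → ℕ
arcCount H = count (size H) (arc H)

_⊆ᵃ_ : {n : ℕ} → (Fin n → Fin n → Bool) → (Fin n → Fin n → Bool) → Set
S ⊆ᵃ R = ∀ u v → S u v ≡ true → R u v ≡ true

data PosWalk {n : ℕ} (R : Fin n → Fin n → Bool) : Fin n → Fin n → Set where
  one  : ∀ {u v} → R u v ≡ true → PosWalk R u v
  cons : ∀ {u w v} → R u w ≡ true → PosWalk R w v → PosWalk R u v

Acyclic : {n : ℕ} → (Fin n → Fin n → Bool) → Set
Acyclic R = ∀ u → ¬ PosWalk R u u

Bipartite : {n : ℕ} → (Fin n → Fin n → Bool) → Set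
Bipartite {n} R = Σ (Fin n → Bool) (λ c → ∀ u v → R u v ≡ true → c u ≢ c v)

IsGamma : Digraph → ℕ → Set
IsGamma H g =
  (∃[ S ] (S ⊆ᵃ arc H × Acyclic S × count (size H) S ≡ g))
  × (∀ S → S ⊆ᵃ arc H → Acyclic S → count (size H) S ≤ g)

IsBip : Digraph → ℕ → Set
IsBip H k =
  (∃[ S ] (S ⊆ᵃ arc H × Bipartite S × count (size H) S ≡ k))
  × (∀ S → S ⊆ᵃ arc H → Bipartite S → count (size H) S ≤ k)

-- The blowup B(L): vertex set V(L) × ℕ (I_v = {v} × ℕ, countably infinite),
-- arcs from (a,i) to (b,j) exactly when (a,b) ∈ E(L).
BVertex : Digraph → Set
BVertex L = Fin (size L) × ℕ

blowArc : (L : Digraph) → BVertex L → BVertex L → Bool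
blowArc L (a , _) (b , _) = arc L a b

-- For an injective placement φ of V(H) into V(B(L)), the number of arcs that
-- must be added to B(L) so that φ becomes a copy of H: the arcs (u,v) of H
-- whose image (φ u, φ v) is not an arc of B(L).
missing : (H L : Digraph) → (Fin (size H) → BVertex L) → ℕ
missing H L φ = count (size H) (λ u v → arc H u v ∧ not (blowArc L (φ u) (φ v)))

IsDisc : Digraph → Digraph → ℕ → Set
IsDisc H L d =
  (∃[ φ ] (Injective _≡_ _≡_ φ × missing H L φ ≡ d))
  × (∀ φ → Injective _≡_ _≡_ φ → d ≤ missing H L φ)

HasArc : Digraph → Set
HasArc L = ∃[ a ] ∃[ b ] (arc L a b ≡ true)

-- |E(L)| / |V(L)|^2   (for |V(L)| = 0 there are no arcs; value 0)
density : Digraph → ℚ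
density L with size L | arcCount L
... | zero  | _ = + 0 / 1
... | suc k | e = + e / (suc k *ℕ suc k)

ℕtoℚ : ℕ → ℚ
ℕtoℚ m = + m / 1

fHL : Digraph → Digraph → ℕ → ℚ
fHL H L d = (ℕtoℚ (arcCount H) * (1ℚ - density L)) ⊔ (ℕtoℚ (arcCount H) - ℕtoℚ d)

module Submission where

-- If |E(L)| ≤ |V(L)|²/2, the first term of f(H,L) is already at least
-- |E(H)|/2.  Otherwise L contains a directed 2-cycle x ⇄ y; sending the two sides of a
-- cut of H that contains at least half of its arcs into I_x and I_y loses only uncut
-- arcs, so disc_H(L) ≤ |E(H)|/2 and the second term is at least |E(H)|/2.
--
-- Copies of H in the blowup of the 2-cycle K₂ are 2-colourings of V(H),
-- and the arcs such a copy keeps form a cut; so |E(H)| − disc_H(K₂) = b(H), while the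
-- density 1/2 of K₂ and |E(H)| ≤ 2b(H) bound the first term by b(H).  In the blowup of
-- the transitive tournament T_N the arcs kept by a copy form an acyclic subgraph, so
-- |E(H)| − disc_H(T_N) ≤ γ(H); the density of T_N is (N − 1)/(2N) and |E(H)| ≤ 2γ(H)
-- (the forward and the backward arcs of any vertex order are acyclic), so the first
-- term is |E(H)|/2 + |E(H)|/(2N) ≤ γ(H) + ε for N large.

module Combinatorics where

  open import Defs using (count; _⊆ᵃ_; PosWalk; one; cons; Acyclic)
  open import Data.Bool using (Bool; true; false; _∧_; not; _xor_; if_then_else_; T)
  open import Data.Bool.Properties using (_≟_)
  open import Data.Unit using (tt)
  open import Data.Nat using (ℕ; zero; suc; _+_; _*_; _≤_; _<_; _<ᵇ_; z≤n; s≤s; _≤?_)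
  import Data.Nat.Properties as ℕP
  import Data.Nat.ListAction as List
  open import Data.Nat.Solver using (module +-*-Solver)
  open import Data.Fin using (Fin; toℕ) renaming (zero to 0F; suc to sucF)
  open import Data.Fin.Properties using (any?)
  open import Data.List using (map; tabulate; allFin)
  open import Data.Vec.Functional using (Vector; _∷_)
  open import Algebra.Properties.CommutativeMonoid.Sum ℕP.+-0-commutativeMonoid
    using (sum; sum-syntax; sum-cong-≗; ∑-distrib-+; ∑-comm)
  open import Data.Product using (∃-syntax; _×_; _,_; proj₁; proj₂)
  open import Data.Empty using (⊥-elim)
  open import Function using (_∘_; flip)
  open import Relation.Binary.Definitions using (Transitive; Irreflexive)
  open import Relation.Binary.PropositionalEquality
  open import Relation.Nullary using (yes; no)

  Arcs : ℕ → Set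
  Arcs n = Fin n → Fin n → Bool

  ∧-true⁻ : ∀ {x y} → x ∧ y ≡ true → x ≡ true × y ≡ true
  ∧-true⁻ {true} y≡true = refl , y≡true

  ∧-⊆ : ∀ {n} {R P : Arcs n} → (λ u v → R u v ∧ P u v) ⊆ᵃ R
  ∧-⊆ u v = proj₁ ∘ ∧-true⁻

  indicator : Bool → ℕ
  indicator b = if b then 1 else 0

  #arcs : ∀ {n} → Arcs n → ℕ
  #arcs {n} R = ∑[ i < n ] ∑[ j < n ] indicator (R i j)

  sum-map-tabulate : ∀ {A : Set} {n} (f : A → ℕ) (g : Fin n → A) →
                     List.sum (map f (tabulate g)) ≡ sum (f ∘ g)
  sum-map-tabulate {n = zero} f g = refl
  sum-map-tabulate {n = suc n} f g = cong (f (g 0F) +_) (sum-map-tabulate f (g ∘ sucF))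

  count≡#arcs : ∀ n (R : Arcs n) → count n R ≡ #arcs R
  count≡#arcs n R = trans (sum-map-tabulate row (λ i → i))
    (sum-cong-≗ (λ i → sum-map-tabulate (λ j → indicator (R i j)) (λ j → j)))
    where
    row : Fin n → ℕ
    row i = List.sum (map (λ j → indicator (R i j)) (allFin n))

  ∑-mono-≤ : ∀ {n} {f g : Fin n → ℕ} → (∀ i → f i ≤ g i) → sum f ≤ sum g
  ∑-mono-≤ {zero} le = z≤n
  ∑-mono-≤ {suc n} le = ℕP.+-mono-≤ (le 0F) (∑-mono-≤ (le ∘ sucF))

  ∑-const : ∀ n c → ∑[ i < n ] c ≡ n * c
  ∑-const zero c = refl
  ∑-const (suc n) c = cong (c +_) (∑-const n c)

  #arcs-cong : ∀ {n} {R S : Arcs n} → (∀ i j → R i j ≡ S i j) → #arcs R ≡ #arcs S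
  #arcs-cong R≡S = sum-cong-≗ (λ i → sum-cong-≗ (λ j → cong indicator (R≡S i j)))

  #arcs-mono : ∀ {n} {S R : Arcs n} → S ⊆ᵃ R → #arcs S ≤ #arcs R
  #arcs-mono S⊆R = ∑-mono-≤ (λ i → ∑-mono-≤ (λ j → pointwise (S⊆R i j)))
    where
    pointwise : ∀ {s r} → (s ≡ true → r ≡ true) → indicator s ≤ indicator r
    pointwise {false} _ = z≤n
    pointwise {true} s⇒r rewrite s⇒r refl = s≤s z≤n

  #arcs-split : ∀ {n} (R P : Arcs n) →
                #arcs R ≡ #arcs (λ i j → R i j ∧ P i j) + #arcs (λ i j → R i j ∧ not (P i j))
  #arcs-split {n} R P = trans
    (sum-cong-≗ (λ i → trans (sum-cong-≗ (λ j → pointwise (R i j) (P i j))) (∑-distrib-+ (kept i) (dropped i))))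
    (∑-distrib-+ (sum ∘ kept) (sum ∘ dropped))
    where
    kept dropped : Fin n → Fin n → ℕ
    kept i j = indicator (R i j ∧ P i j)
    dropped i j = indicator (R i j ∧ not (P i j))
    pointwise : ∀ r p → indicator r ≡ indicator (r ∧ p) + indicator (r ∧ not p)
    pointwise false p = refl
    pointwise true false = refl
    pointwise true true = refl

  #arcs-flip : ∀ {n} (R : Arcs n) → #arcs (flip R) ≡ #arcs R
  #arcs-flip R = ∑-comm (λ j i → indicator (R i j))

  links : ∀ {n} → Arcs (suc n) → ℕ
  links {n} R = ∑[ j < n ] (indicator (R 0F (sucF j)) + indicator (R (sucF j) 0F))

  #arcs-suc : ∀ {n} (R : Arcs (suc n)) →
              #arcs R ≡ indicator (R 0F 0F) + links R + #arcs (λ i j → R (sucF i) (sucF j))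
  #arcs-suc {n} R = begin
    (loop + out) + ∑[ i < n ] (into i + inner i) ≡⟨ cong ((loop + out) +_) (∑-distrib-+ into inner) ⟩
    (loop + out) + (sum into + sum inner)       ≡⟨ solve 4 (λ a b c d → (a :+ b) :+ (c :+ d) := a :+ (b :+ c) :+ d)
                                                          refl loop out (sum into) (sum inner) ⟩
    loop + (out + sum into) + sum inner         ≡⟨ cong (λ x → loop + x + sum inner) links≡ ⟩
    loop + links R + sum inner                  ∎
    where
    open ≡-Reasoning
    open +-*-Solver
    outᵢ into inner : Fin n → ℕ
    outᵢ j = indicator (R 0F (sucF j))
    into i = indicator (R (sucF i) 0F)
    inner i = ∑[ j < n ] indicator (R (sucF i) (sucF j))
    loop out : ℕ
    loop = indicator (R 0F 0F)
    out = sum outᵢ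
    links≡ : out + sum into ≡ links R
    links≡ = sym (∑-distrib-+ outᵢ into)

  cut : ∀ {n} → Arcs n → Vector Bool n → Arcs n
  cut R c i j = R i j ∧ (c i xor c j)

  pick-larger : (f : Bool → ℕ) → ∃[ b ] f true + f false ≤ f b + f b
  pick-larger f with f false ≤? f true
  ... | yes le = true , ℕP.+-monoʳ-≤ (f true) le
  ... | no ≰ = false , ℕP.+-monoˡ-≤ (f false) (ℕP.<⇒≤ (ℕP.≰⇒> ≰))

  links-cut : ∀ {n} (R : Arcs (suc n)) (c : Vector Bool n) →
              links (cut R (true ∷ c)) + links (cut R (false ∷ c)) ≡ links R
  links-cut {n} R c = trans (sym (∑-distrib-+ (link true) (link false)))
    (sum-cong-≗ (λ j → pointwise (R 0F (sucF j)) (R (sucF j) 0F) (c j)))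
    where
    link : Bool → Fin n → ℕ
    link b j = indicator (cut R (b ∷ c) 0F (sucF j)) + indicator (cut R (b ∷ c) (sucF j) 0F)
    pointwise : ∀ x y z → indicator (x ∧ (true xor z)) + indicator (y ∧ (z xor true))
                          + (indicator (x ∧ (false xor z)) + indicator (y ∧ (z xor false)))
                          ≡ indicator x + indicator y
    pointwise false false z = refl
    pointwise false true false = refl
    pointwise false true true = refl
    pointwise true false false = refl
    pointwise true false true = refl
    pointwise true true false = refl
    pointwise true true true = refl

  -- Greedy: the new vertex takes the colour that cuts at least half of its arcs to the others.
  maxCut : ∀ {n} (R : Arcs n) → (∀ i → R i i ≡ false) → ∃[ c ] #arcs R ≤ #arcs (cut R c) + #arcs (cut R c)
  maxCut {zero} R _ = (λ ()) , z≤n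
  maxCut {suc n} R loopless with maxCut (λ i j → R (sucF i) (sucF j)) (loopless ∘ sucF)
  ... | c , inner-cut with pick-larger (λ b → links (cut R (b ∷ c)))
  ... | b , gain = b ∷ c , (begin
    #arcs R                                          ≡⟨ #arcs-suc R ⟩
    indicator (R 0F 0F) + links R + #arcs R′         ≡⟨ cong (λ x → indicator x + links R + #arcs R′) (loopless 0F) ⟩
    links R + #arcs R′                               ≡⟨ cong (_+ #arcs R′) (sym (links-cut R c)) ⟩
    links (cut R (true ∷ c)) + links (cut R (false ∷ c)) + #arcs R′
                                                     ≤⟨ ℕP.+-mono-≤ gain inner-cut ⟩
    (ℓ + ℓ) + (#arcs (cut R′ c) + #arcs (cut R′ c))  ≡⟨ solve 2 (λ l i → (l :+ l) :+ (i :+ i) := (l :+ i) :+ (l :+ i))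
                                                               refl ℓ (#arcs (cut R′ c)) ⟩
    (ℓ + #arcs (cut R′ c)) + (ℓ + #arcs (cut R′ c))  ≡⟨ cong₂ _+_ (sym #cut) (sym #cut) ⟩
    #arcs (cut R (b ∷ c)) + #arcs (cut R (b ∷ c))    ∎)
    where
    open ℕP.≤-Reasoning
    open +-*-Solver
    R′ : Arcs n
    R′ i j = R (sucF i) (sucF j)
    ℓ : ℕ
    ℓ = links (cut R (b ∷ c))
    #cut : #arcs (cut R (b ∷ c)) ≡ ℓ + #arcs (cut R′ c)
    #cut = trans (#arcs-suc (cut R (b ∷ c)))
      (cong (λ x → indicator (x ∧ (b xor b)) + ℓ + #arcs (cut R′ c)) (loopless 0F))

  two-cycle-free⇒sparse : ∀ {n} (R : Arcs n) → (∀ i j → R i j ∧ R j i ≡ false) → #arcs R + #arcs R ≤ n * n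
  two-cycle-free⇒sparse {n} R free = begin
    #arcs R + #arcs R                            ≡⟨ cong (#arcs R +_) (sym (#arcs-flip R)) ⟩
    #arcs R + #arcs (flip R)                     ≡⟨ sym (∑-distrib-+ (sum ∘ out) (sum ∘ flip out)) ⟩
    ∑[ i < n ] (sum (out i) + sum (flip out i))  ≡⟨ sum-cong-≗ (λ i → sym (∑-distrib-+ (out i) (flip out i))) ⟩
    ∑[ i < n ] ∑[ j < n ] (out i j + out j i)    ≤⟨ ∑-mono-≤ (λ i → ∑-mono-≤ (at-most-one i)) ⟩
    ∑[ i < n ] ∑[ j < n ] 1                      ≡⟨ sum-cong-≗ {n} (λ i → trans (∑-const n 1) (ℕP.*-identityʳ n)) ⟩
    ∑[ i < n ] n                                 ≡⟨ ∑-const n n ⟩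
    n * n                                        ∎
    where
    open ℕP.≤-Reasoning
    out : Fin n → Fin n → ℕ
    out i j = indicator (R i j)
    ≤1 : ∀ x y → x ∧ y ≡ false → indicator x + indicator y ≤ 1
    ≤1 false false _ = z≤n
    ≤1 false true _ = s≤s z≤n
    ≤1 true false _ = s≤s z≤n
    at-most-one : ∀ i j → out i j + out j i ≤ 1
    at-most-one i j = ≤1 (R i j) (R j i) (free i j)

  dense⇒two-cycle : ∀ {n} (R : Arcs n) → n * n < #arcs R + #arcs R →
                    ∃[ i ] ∃[ j ] (R i j ≡ true × R j i ≡ true)
  dense⇒two-cycle R dense with any? (λ i → any? (λ j → R i j ∧ R j i ≟ true))
  ... | yes (i , j , both) = i , j , ∧-true⁻ both
  ... | no none = ⊥-elim (ℕP.<⇒≱ dense (two-cycle-free⇒sparse R free))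
    where
    free : ∀ i j → R i j ∧ R j i ≡ false
    free i j with R i j ∧ R j i in both
    ... | false = refl
    ... | true = ⊥-elim (none (i , j , both))

  acyclic-by-rank : ∀ {n} {A : Set} {_≺_ : A → A → Set} → Transitive _≺_ → Irreflexive _≡_ _≺_ →
                    (rank : Fin n → A) (R : Arcs n) → (∀ u v → R u v ≡ true → rank u ≺ rank v) → Acyclic R
  acyclic-by-rank {_≺_ = _≺_} ≺-trans ≺-irrefl rank R rank-increases u walk = ≺-irrefl refl (along walk)
    where
    along : ∀ {u v} → PosWalk R u v → rank u ≺ rank v
    along (one uv) = rank-increases _ _ uv
    along (cons uw wv) = ≺-trans (rank-increases _ _ uw) (along wv)

  <ᵇ-true⇒< : ∀ {m n} → (m <ᵇ n) ≡ true → m < n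
  <ᵇ-true⇒< {m} {n} eq = ℕP.<ᵇ⇒< m n (subst T (sym eq) tt)

  <ᵇ-false⇒≥ : ∀ {m n} → (m <ᵇ n) ≡ false → n ≤ m
  <ᵇ-false⇒≥ eq = ℕP.≮⇒≥ (λ m<n → subst T eq (ℕP.<⇒<ᵇ m<n))

  <ᵇ-irrefl : ∀ n → (n <ᵇ n) ≡ false
  <ᵇ-irrefl zero = refl
  <ᵇ-irrefl (suc n) = <ᵇ-irrefl n

  precedes : ∀ {n} → Arcs n
  precedes i j = toℕ i <ᵇ toℕ j

  ascending-acyclic : ∀ {n m} (σ : Fin n → Fin m) (P : Arcs n) → Acyclic (λ u v → P u v ∧ precedes (σ u) (σ v))
  ascending-acyclic σ P =
    acyclic-by-rank ℕP.<-trans ℕP.<-irrefl (toℕ ∘ σ) _ (λ u v → <ᵇ-true⇒< ∘ proj₂ ∘ ∧-true⁻)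

  #arcs-precedes : ∀ n → #arcs (precedes {n}) + #arcs (precedes {n}) + n ≡ n * n
  #arcs-precedes zero = refl
  #arcs-precedes (suc n) = begin
    E′ + E′ + suc n             ≡⟨ cong (λ x → x + x + suc n) E′≡n+E ⟩
    (n + E) + (n + E) + suc n   ≡⟨ solve 2 (λ n E → (n :+ E) :+ (n :+ E) :+ (con 1 :+ n)
                                                  := (E :+ E :+ n) :+ (con 1 :+ n :+ n)) refl n E ⟩
    (E + E + n) + (suc n + n)   ≡⟨ cong (_+ (suc n + n)) (#arcs-precedes n) ⟩
    n * n + (suc n + n)         ≡⟨ solve 1 (λ n → n :* n :+ (con 1 :+ n :+ n) := (con 1 :+ n) :* (con 1 :+ n))
                                         refl n ⟩
    suc n * suc n               ∎
    where
    open ≡-Reasoning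
    open +-*-Solver
    E E′ : ℕ
    E = #arcs (precedes {n})
    E′ = #arcs (precedes {suc n})
    E′≡n+E : E′ ≡ n + E
    E′≡n+E = trans (#arcs-suc (precedes {suc n})) (cong (_+ E) (trans (∑-const n 1) (ℕP.*-identityʳ n)))

  Fin-argmin : ∀ {N} (F : Fin (suc N) → ℕ) → ∃[ x ] (∀ y → F x ≤ F y)
  Fin-argmin {zero} F = 0F , λ { 0F → ℕP.≤-refl }
  Fin-argmin {suc N} F with Fin-argmin (F ∘ sucF)
  ... | x , x-min with F 0F ≤? F (sucF x)
  ...   | yes 0≤x = 0F , λ { 0F → ℕP.≤-refl ; (sucF y) → ℕP.≤-trans 0≤x (x-min y) }
  ...   | no 0≰x = sucF x , λ { 0F → ℕP.<⇒≤ (ℕP.≰⇒> 0≰x) ; (sucF y) → x-min y }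

  Vector-argmin : ∀ h {N} (F : Vector (Fin (suc N)) h → ℕ) → (∀ {σ τ} → σ ≗ τ → F σ ≡ F τ) →
                  ∃[ σ ] (∀ τ → F σ ≤ F τ)
  Vector-argmin zero F F-cong = (λ ()) , λ τ → ℕP.≤-reflexive (F-cong (λ ()))
  Vector-argmin (suc h) {N} F F-cong = x ∷ best x , minimal
    where
    best-tail : ∀ x → ∃[ τ ] (∀ τ′ → F (x ∷ τ) ≤ F (x ∷ τ′))
    best-tail x = Vector-argmin h (λ τ → F (x ∷ τ))
                                (λ σ≗τ → F-cong (λ { 0F → refl ; (sucF i) → σ≗τ i }))
    best : Fin (suc N) → Vector (Fin (suc N)) h
    best x = proj₁ (best-tail x)
    x = proj₁ (Fin-argmin (λ x → F (x ∷ best x)))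
    η : ∀ τ → F (τ 0F ∷ τ ∘ sucF) ≡ F τ
    η τ = F-cong (λ { 0F → refl ; (sucF i) → refl })
    minimal : ∀ τ → F (x ∷ best x) ≤ F τ
    minimal τ = ℕP.≤-trans (proj₂ (Fin-argmin (λ x → F (x ∷ best x))) (τ 0F))
      (ℕP.≤-trans (proj₂ (best-tail (τ 0F)) (τ ∘ sucF)) (ℕP.≤-reflexive (η τ)))

module Fractions where

  open import Defs using (ℕtoℚ)
  open import Data.Nat as ℕ using (ℕ; suc)
  import Data.Nat.Properties as ℕP
  import Data.Nat.Solver as ℕSolver
  open import Data.Integer as ℤ using (+_; +[1+_])
  import Data.Integer.Properties as ℤP
  open import Data.Rational using (ℚ; _/_; _+_; _*_; _-_; -_; 1ℚ; mkℚ; toℚᵘ; Positive; _≤_)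
  import Data.Rational.Properties as ℚP
  import Data.Rational.Solver as ℚSolver
  open import Data.Rational.Unnormalised as ℚᵘ using (mkℚᵘ; *≡*; *≤*) renaming (_≃_ to _≃ᵘ_)
  import Data.Rational.Unnormalised.Properties as ℚᵘP
  open import Data.Product using (∃; _,_)
  open import Relation.Binary.PropositionalEquality

  toℚᵘ-/ : ∀ n d → toℚᵘ (+ n / suc d) ≃ᵘ mkℚᵘ (+ n) d
  toℚᵘ-/ n d = ℚP.toℚᵘ-fromℚᵘ (mkℚᵘ (+ n) d)

  /≡/ : ∀ m b n d → m ℕ.* suc d ≡ n ℕ.* suc b → + m / suc b ≡ + n / suc d
  /≡/ m b n d eq = ℚP.toℚᵘ-injective (begin
    toℚᵘ (+ m / suc b) ≈⟨ toℚᵘ-/ m b ⟩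
    mkℚᵘ (+ m) b       ≈⟨ *≡* cross ⟩
    mkℚᵘ (+ n) d       ≈⟨ ℚᵘP.≃-sym (toℚᵘ-/ n d) ⟩
    toℚᵘ (+ n / suc d) ∎)
    where
    open ℚᵘP.≃-Reasoning
    cross : + m ℤ.* + suc d ≡ + n ℤ.* + suc b
    cross = trans (sym (ℤP.pos-* m (suc d))) (trans (cong +_ eq) (ℤP.pos-* n (suc b)))

  /≤/ : ∀ m b n d → m ℕ.* suc d ℕ.≤ n ℕ.* suc b → + m / suc b ≤ + n / suc d
  /≤/ m b n d le = ℚP.toℚᵘ-cancel-≤
    (ℚᵘP.≤-respˡ-≃ (ℚᵘP.≃-sym (toℚᵘ-/ m b))
      (ℚᵘP.≤-respʳ-≃ (ℚᵘP.≃-sym (toℚᵘ-/ n d)) (*≤* cross)))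
    where
    cross : + m ℤ.* + suc d ℤ.≤ + n ℤ.* + suc b
    cross = subst₂ ℤ._≤_ (ℤP.pos-* m (suc d)) (ℤP.pos-* n (suc b)) (ℤ.+≤+ le)

  /+/ : ∀ a b c d → + a / suc b + + c / suc d ≡ + (a ℕ.* suc d ℕ.+ c ℕ.* suc b) / (suc b ℕ.* suc d)
  /+/ a b c d = ℚP.toℚᵘ-injective (begin
    toℚᵘ (+ a / suc b + + c / suc d)            ≈⟨ ℚP.toℚᵘ-homo-+ (+ a / suc b) (+ c / suc d) ⟩
    toℚᵘ (+ a / suc b) ℚᵘ.+ toℚᵘ (+ c / suc d)  ≈⟨ ℚᵘP.+-cong (toℚᵘ-/ a b) (toℚᵘ-/ c d) ⟩
    mkℚᵘ (+ a) b ℚᵘ.+ mkℚᵘ (+ c) d              ≈⟨ ℚᵘP.≃-reflexive (cong (λ i → mkℚᵘ i _) numerator) ⟩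
    mkℚᵘ (+ n) _                                 ≈⟨ ℚᵘP.≃-sym (toℚᵘ-/ n _) ⟩
    toℚᵘ (+ n / (suc b ℕ.* suc d))               ∎)
    where
    open ℚᵘP.≃-Reasoning
    n : ℕ
    n = a ℕ.* suc d ℕ.+ c ℕ.* suc b
    numerator : + a ℤ.* + suc d ℤ.+ + c ℤ.* + suc b ≡ + n
    numerator = sym (trans (ℤP.pos-+ (a ℕ.* suc d) (c ℕ.* suc b))
                           (cong₂ ℤ._+_ (ℤP.pos-* a (suc d)) (ℤP.pos-* c (suc b))))

  /*/ : ∀ a b c d → + a / suc b * (+ c / suc d) ≡ + (a ℕ.* c) / (suc b ℕ.* suc d)
  /*/ a b c d = ℚP.toℚᵘ-injective (begin
    toℚᵘ (+ a / suc b * (+ c / suc d))          ≈⟨ ℚP.toℚᵘ-homo-* (+ a / suc b) (+ c / suc d) ⟩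
    toℚᵘ (+ a / suc b) ℚᵘ.* toℚᵘ (+ c / suc d)  ≈⟨ ℚᵘP.*-cong (toℚᵘ-/ a b) (toℚᵘ-/ c d) ⟩
    mkℚᵘ (+ a) b ℚᵘ.* mkℚᵘ (+ c) d              ≈⟨ ℚᵘP.≃-reflexive (cong (λ i → mkℚᵘ i _) numerator) ⟩
    mkℚᵘ (+ (a ℕ.* c)) _                         ≈⟨ ℚᵘP.≃-sym (toℚᵘ-/ _ _) ⟩
    toℚᵘ (+ (a ℕ.* c) / (suc b ℕ.* suc d))       ∎)
    where
    open ℚᵘP.≃-Reasoning
    numerator : + a ℤ.* + c ≡ + (a ℕ.* c)
    numerator = sym (ℤP.pos-* a c)

  /+/-same : ∀ a c m → + a / suc m + + c / suc m ≡ + (a ℕ.+ c) / suc m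
  /+/-same a c m = trans (/+/ a m c m)
    (/≡/ (a ℕ.* suc m ℕ.+ c ℕ.* suc m) (m ℕ.+ m ℕ.* suc m) (a ℕ.+ c) m
         (solve 3 (λ a c s → (a :* s :+ c :* s) :* s := (a :+ c) :* (s :* s)) refl a c (suc m)))
    where open ℕSolver.+-*-Solver

  /-/ : ∀ a r {c} m → a ℕ.+ r ≡ c → + c / suc m - + a / suc m ≡ + r / suc m
  /-/ a r m refl = begin
    + (a ℕ.+ r) / suc m - x  ≡⟨ cong (_- x) (sym (/+/-same a r m)) ⟩
    (x + y) - x              ≡⟨ solve 2 (λ x y → (x :+ y) :- x := y) refl x y ⟩
    y                        ∎
    where
    open ≡-Reasoning
    open ℚSolver.+-*-Solver
    x y : ℚ
    x = + a / suc m
    y = + r / suc m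

  ℕtoℚ-mono-≤ : ∀ {m n} → m ℕ.≤ n → ℕtoℚ m ≤ ℕtoℚ n
  ℕtoℚ-mono-≤ {m} {n} le = /≤/ m 0 n 0 (ℕP.*-monoˡ-≤ 1 le)

  ℕtoℚ-+ : ∀ m n → ℕtoℚ (m ℕ.+ n) ≡ ℕtoℚ m + ℕtoℚ n
  ℕtoℚ-+ m n = sym (/+/-same m n 0)

  ℕtoℚ+1/ : ∀ k q → ℕtoℚ k + + 1 / suc q ≡ + (k ℕ.* suc q ℕ.+ 1) / suc q
  ℕtoℚ+1/ k q = trans (/+/ k 0 1 q)
    (/≡/ (k ℕ.* suc q ℕ.+ 1 ℕ.* 1) (q ℕ.+ 0) (k ℕ.* suc q ℕ.+ 1) q
         (solve 2 (λ k s → (k :* s :+ con 1 :* con 1) :* s := (k :* s :+ con 1) :* (con 1 :* s)) refl k (suc q)))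
    where open ℕSolver.+-*-Solver

  ≤+1/ : ∀ k q → ℕtoℚ k ≤ ℕtoℚ k + + 1 / suc q
  ≤+1/ k q = subst (ℕtoℚ k ≤_) (sym (ℕtoℚ+1/ k q))
    (/≤/ k 0 (k ℕ.* suc q ℕ.+ 1) q (subst (k ℕ.* suc q ℕ.≤_) (sym (ℕP.*-identityʳ _)) (ℕP.m≤m+n _ 1)))

  1/suc≤pos : ∀ ε → Positive ε → ∃ λ q → + 1 / suc q ≤ ε
  1/suc≤pos (mkℚ +[1+ p ] q c) _ = q , subst (+ 1 / suc q ≤_) (ℚP.normalize-coprime c)
    (/≤/ 1 q (suc p) q (ℕP.*-monoˡ-≤ (suc q) (ℕ.s≤s (ℕ.z≤n {p}))))

  complement : ∀ e {E r m} → E ℕ.+ r ≡ suc m → ℕtoℚ e * (1ℚ - + E / suc m) ≡ + (e ℕ.* r) / suc m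
  complement e {E} {r} {m} eq = begin
    ℕtoℚ e * (1ℚ - + E / suc m)               ≡⟨ cong (λ x → ℕtoℚ e * (x - + E / suc m)) 1≡M/M ⟩
    ℕtoℚ e * (+ suc m / suc m - + E / suc m)  ≡⟨ cong (ℕtoℚ e *_) (/-/ E r m eq) ⟩
    ℕtoℚ e * (+ r / suc m)                    ≡⟨ /*/ e 0 r m ⟩
    + (e ℕ.* r) / (1 ℕ.* suc m)               ≡⟨ /≡/ (e ℕ.* r) (m ℕ.+ 0) (e ℕ.* r) m (cong (e ℕ.* r ℕ.*_) M≡1*M) ⟩
    + (e ℕ.* r) / suc m                       ∎
    where
    open ≡-Reasoning
    M≡1*M : suc m ≡ 1 ℕ.* suc m
    M≡1*M = sym (ℕP.*-identityˡ (suc m))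
    1≡M/M : 1ℚ ≡ + suc m / suc m
    1≡M/M = /≡/ 1 0 (suc m) m (ℕP.*-comm 1 (suc m))

  ∸-doubles : ∀ a {c} → a ℕ.+ a ℕ.≤ c → c ℕ.≤ (c ℕ.∸ a) ℕ.+ (c ℕ.∸ a)
  ∸-doubles a {c} le = subst (ℕ._≤ r ℕ.+ r) (ℕP.m+[n∸m]≡n a≤c) (ℕP.+-monoˡ-≤ r a≤r)
    where
    r : ℕ
    r = c ℕ.∸ a
    a≤c : a ℕ.≤ c
    a≤c = ℕP.≤-trans (ℕP.m≤m+n a a) le
    a≤r : a ℕ.≤ r
    a≤r = ℕP.+-cancelˡ-≤ a a r (subst (a ℕ.+ a ℕ.≤_) (sym (ℕP.m+[n∸m]≡n a≤c)) le)

  half≤complement : ∀ e E {m} → E ℕ.+ E ℕ.≤ suc m → + e / 2 ≤ ℕtoℚ e * (1ℚ - + E / suc m)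
  half≤complement e E {m} le = subst (+ e / 2 ≤_) (sym (complement e (ℕP.m+[n∸m]≡n E≤M)))
    (/≤/ e 1 (e ℕ.* r) m (subst (e ℕ.* suc m ℕ.≤_) (solve 2 (λ e r → e :* (r :+ r) := e :* r :* con 2) refl e r)
                                (ℕP.*-monoʳ-≤ e (∸-doubles E le))))
    where
    open ℕSolver.+-*-Solver
    r : ℕ
    r = suc m ℕ.∸ E
    E≤M : E ℕ.≤ suc m
    E≤M = ℕP.≤-trans (ℕP.m≤m+n E E) le

  half≤difference : ∀ e d → d ℕ.+ d ℕ.≤ e → + e / 2 ≤ ℕtoℚ e - ℕtoℚ d
  half≤difference e d le = subst (+ e / 2 ≤_) (sym (/-/ d r 0 (ℕP.m+[n∸m]≡n d≤e)))
    (/≤/ e 1 r 0 (subst₂ ℕ._≤_ (sym (ℕP.*-identityʳ e)) (solve 1 (λ r → r :+ r := r :* con 2) refl r)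
                         (∸-doubles d le)))
    where
    open ℕSolver.+-*-Solver
    r : ℕ
    r = e ℕ.∸ d
    d≤e : d ℕ.≤ e
    d≤e = ℕP.≤-trans (ℕP.m≤m+n d d) le

  difference≤ : ∀ e d k → e ℕ.≤ d ℕ.+ k → ℕtoℚ e - ℕtoℚ d ≤ ℕtoℚ k
  difference≤ e d k le = subst (ℕtoℚ e - ℕtoℚ d ≤_)
    (solve 2 (λ d k → (d :+ k) :- d := k) refl (ℕtoℚ d) (ℕtoℚ k))
    (ℚP.+-monoˡ-≤ (- ℕtoℚ d) (subst (ℕtoℚ e ≤_) (ℕtoℚ-+ d k) (ℕtoℚ-mono-≤ le)))
    where open ℚSolver.+-*-Solver

  complement≤ : ∀ e k E r {m} q → E ℕ.+ r ≡ suc m →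
                e ℕ.* r ℕ.* suc q ℕ.≤ (k ℕ.* suc q ℕ.+ 1) ℕ.* suc m →
                ℕtoℚ e * (1ℚ - + E / suc m) ≤ ℕtoℚ k + + 1 / suc q
  complement≤ e k E r {m} q eq le = subst₂ _≤_ (sym (complement e eq)) (sym (ℕtoℚ+1/ k q))
    (/≤/ (e ℕ.* r) m (k ℕ.* suc q ℕ.+ 1) q le)

module Bounds where

  open import Defs
  open Combinatorics
  open Fractions
  open import Data.Bool using (Bool; true; false; _∧_; not; _xor_; if_then_else_)
  open import Data.Bool.Properties using (xor-same; not-injective)
  open import Data.Nat using (ℕ; zero; suc; _+_; _*_; _≤_; _<_; _≤?_)
  import Data.Nat.Properties as ℕP
  open import Data.Nat.Solver using (module +-*-Solver)
  open import Data.Fin using (Fin; toℕ) renaming (zero to 0F; suc to sucF)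
  import Data.Fin.Properties as FinP
  open import Data.Vec.Functional using (Vector)
  open import Data.Product using (∃-syntax; _×_; _,_; proj₁; proj₂)
  import Data.Integer as ℤ
  open import Data.Rational as ℚ using (ℚ; _/_; 1ℚ)
  import Data.Rational.Properties as ℚP
  open import Function using (_∘_; flip)
  open import Function.Definitions using (Injective)
  open import Relation.Binary.PropositionalEquality
  open import Relation.Nullary using (yes; no)
  open import Data.Empty using (⊥-elim)

  xor-true⇒≢ : ∀ {a b} → a xor b ≡ true → a ≢ b
  xor-true⇒≢ {a} a⊕b refl with () ← trans (sym (xor-same a)) a⊕b

  ≢⇒xor-true : ∀ {a b} → a ≢ b → a xor b ≡ true
  ≢⇒xor-true {false} {false} a≢b = ⊥-elim (a≢b refl)
  ≢⇒xor-true {false} {true} _ = refl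
  ≢⇒xor-true {true} {false} _ = refl
  ≢⇒xor-true {true} {true} a≢b = ⊥-elim (a≢b refl)

  cut-bipartite : ∀ {n} (R : Arcs n) c → Bipartite (cut R c)
  cut-bipartite R c = c , λ u v uv → xor-true⇒≢ (proj₂ (∧-true⁻ uv))

  side : Fin 2 → Bool
  side 0F = false
  side (sucF _) = true

  vertex : Bool → Fin 2
  vertex false = 0F
  vertex true = sucF 0F

  side-vertex : ∀ b → side (vertex b) ≡ b
  side-vertex false = refl
  side-vertex true = refl

  K₂ : Digraph
  K₂ = record { size = 2 ; arc = λ i j → side i xor side j ; loopless = λ i → xor-same (side i) }

  tournament : ℕ → Digraph
  tournament n = record { size = n ; arc = precedes ; loopless = <ᵇ-irrefl ∘ toℕ }

  -- With E = (N² − N)/2 arcs in T_N this is e(E + N)/N² ≤ g + 1/s, i.e. e/2 + e/(2N) ≤ g + 1/s.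
  tournament-arith : ∀ e g s E N → E + E + N ≡ N * N → e ≤ g + g → e * s ≤ N →
                     e * (E + N) * s ≤ (g * s + 1) * (N * N)
  tournament-arith e g s E N E+E+N≡N² e≤2g es≤N = ℕP.*-cancelˡ-≤ 2 (begin
    2 * (e * (E + N) * s)                  ≡⟨ solve 4 (λ e s E N → con 2 :* (e :* (E :+ N) :* s)
                                                                 := e :* s :* (E :+ E :+ N) :+ e :* s :* N) refl e s E N ⟩
    e * s * (E + E + N) + e * s * N        ≡⟨ cong (λ x → e * s * x + e * s * N) E+E+N≡N² ⟩
    e * s * (N * N) + e * s * N            ≤⟨ ℕP.+-mono-≤ (ℕP.*-monoˡ-≤ (N * N) (ℕP.*-monoˡ-≤ s e≤2g))
                                                           (ℕP.*-monoˡ-≤ N es≤N) ⟩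
    (g + g) * s * (N * N) + N * N          ≤⟨ ℕP.m≤m+n _ (N * N) ⟩
    (g + g) * s * (N * N) + N * N + N * N  ≡⟨ solve 3 (λ g s M → (g :+ g) :* s :* M :+ M :+ M := con 2 :* ((g :* s :+ con 1) :* M))
                                                      refl g s (N * N) ⟩
    2 * ((g * s + 1) * (N * N))            ∎)
    where
    open ℕP.≤-Reasoning
    open +-*-Solver

  module _ (H : Digraph) where

    place : (L : Digraph) → Vector (Fin (size L)) (size H) → Fin (size H) → BVertex L
    place L σ u = σ u , toℕ u

    place-injective : ∀ L σ → Injective _≡_ _≡_ (place L σ)
    place-injective L σ eq = FinP.toℕ-injective (cong proj₂ eq)

    kept lost : (L : Digraph) → (Fin (size H) → BVertex L) → Arcs (size H)
    kept L ψ u v = arc H u v ∧ arc L (proj₁ (ψ u)) (proj₁ (ψ v))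
    lost L ψ u v = arc H u v ∧ not (arc L (proj₁ (ψ u)) (proj₁ (ψ v)))

    missing≡#lost : ∀ L ψ → missing H L ψ ≡ #arcs (lost L ψ)
    missing≡#lost L ψ = count≡#arcs (size H) (lost L ψ)

    arcCount≡kept+missing : ∀ L ψ → arcCount H ≡ #arcs (kept L ψ) + missing H L ψ
    arcCount≡kept+missing L ψ = trans (count≡#arcs _ (arc H))
      (trans (#arcs-split (arc H) (λ u v → arc L (proj₁ (ψ u)) (proj₁ (ψ v))))
             (cong (#arcs (kept L ψ) +_) (sym (missing≡#lost L ψ))))

    disc-halved-by-two-cycle : ∀ L {x y d} → arc L x y ≡ true → arc L y x ≡ true → IsDisc H L d →
                               d + d ≤ arcCount H
    disc-halved-by-two-cycle L {x} {y} {d} xy yx (_ , d-min) = begin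
      d + d            ≤⟨ ℕP.+-mono-≤ d≤uncut d≤uncut ⟩
      #uncut + #uncut  ≤⟨ ℕP.+-monoˡ-≤ #uncut uncut≤cut ⟩
      #cut + #uncut    ≡⟨ sym e≡cut+uncut ⟩
      arcCount H       ∎
      where
      open ℕP.≤-Reasoning
      c : Vector Bool (size H)
      c = proj₁ (maxCut (arc H) (loopless H))
      σ : Vector (Fin (size L)) (size H)
      σ u = if c u then x else y
      uncut : Arcs (size H)
      uncut u v = arc H u v ∧ not (c u xor c v)
      #cut #uncut : ℕ
      #cut = #arcs (cut (arc H) c)
      #uncut = #arcs uncut
      e≡cut+uncut : arcCount H ≡ #cut + #uncut
      e≡cut+uncut = trans (count≡#arcs _ (arc H)) (#arcs-split (arc H) (λ u v → c u xor c v))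
      uncut≤cut : #uncut ≤ #cut
      uncut≤cut = ℕP.+-cancelˡ-≤ #cut #uncut #cut (begin
        #cut + #uncut  ≡⟨ sym e≡cut+uncut ⟩
        arcCount H     ≡⟨ count≡#arcs _ (arc H) ⟩
        #arcs (arc H)  ≤⟨ proj₂ (maxCut (arc H) (loopless H)) ⟩
        #cut + #cut    ∎)
      lost⊆uncut : lost L (place L σ) ⊆ᵃ uncut
      lost⊆uncut u v h with c u | c v
      ... | false | false rewrite loopless L y = h
      ... | true  | true  rewrite loopless L x = h
      ... | true  | false rewrite xy with () ← proj₂ (∧-true⁻ {arc H u v} h)
      ... | false | true  rewrite yx with () ← proj₂ (∧-true⁻ {arc H u v} h)
      d≤uncut : d ≤ #uncut
      d≤uncut = ℕP.≤-trans (d-min (place L σ) (place-injective L σ))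
        (subst (_≤ #uncut) (sym (missing≡#lost L (place L σ))) (#arcs-mono lost⊆uncut))

    lower-bound : (L : Digraph) → HasArc L → (d : ℕ) → IsDisc H L d → ℤ.+ arcCount H / 2 ℚ.≤ fHL H L d
    lower-bound record { size = zero } (() , _)
    lower-bound L@(record { size = suc n ; arc = a }) _ d disc with arcCount L + arcCount L ≤? suc n * suc n
    ... | yes sparse =
      ℚP.p≤q⇒p≤q⊔r (ℕtoℚ (arcCount H) ℚ.- ℕtoℚ d) (half≤complement (arcCount H) (arcCount L) sparse)
    ... | no ¬sparse with dense⇒two-cycle a (subst (suc n * suc n <_) (cong₂ _+_ (count≡#arcs _ a) (count≡#arcs _ a))
                                                    (ℕP.≰⇒> ¬sparse))
    ...   | x , y , xy , yx = ℚP.p≤q⇒p≤r⊔q (ℕtoℚ (arcCount H) ℚ.* (1ℚ ℚ.- density L))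
                                (half≤difference (arcCount H) d (disc-halved-by-two-cycle L xy yx disc))

    f≤ : ℚ → Set
    f≤ y = ∃[ L ] ∃[ d ] (HasArc L × IsDisc H L d × fHL H L d ℚ.≤ y)

    f≤-mono : ∀ {y z} → y ℚ.≤ z → f≤ y → f≤ z
    f≤-mono y≤z (L , d , L-arc , disc , f≤y) = L , d , L-arc , disc , ℚP.≤-trans f≤y y≤z

    upper-bound : ∀ L d x q → ℕtoℚ (arcCount H) ℚ.* (1ℚ ℚ.- density L) ℚ.≤ ℕtoℚ x ℚ.+ ℤ.+ 1 / suc q →
                  arcCount H ≤ d + x → fHL H L d ℚ.≤ ℕtoℚ x ℚ.+ ℤ.+ 1 / suc q
    upper-bound L d x q complement-bound e≤d+x =
      ℚP.⊔-lub complement-bound (ℚP.≤-trans (difference≤ (arcCount H) d x e≤d+x) (≤+1/ x q))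

    bip-upper : ∀ k → IsBip H k → ∀ q → f≤ (ℕtoℚ k ℚ.+ ℤ.+ 1 / suc q)
    bip-upper k ((S , S⊆H , (c , c-splits) , #S) , k-max) q =
      K₂ , d₀ , (0F , sucF 0F , refl) , ((φ₀ , place-injective K₂ (vertex ∘ c) , refl) , d₀-min) ,
      upper-bound K₂ d₀ k q (complement≤ e k 2 2 q refl e*2*s≤) e≤d₀+k
      where
      open ℕP.≤-Reasoning
      e : ℕ
      e = arcCount H
      φ₀ : Fin (size H) → BVertex K₂
      φ₀ = place K₂ (vertex ∘ c)
      d₀ : ℕ
      d₀ = missing H K₂ φ₀
      cut≤k : ∀ c′ → #arcs (cut (arc H) c′) ≤ k
      cut≤k c′ = subst (_≤ k) (count≡#arcs (size H) (cut (arc H) c′))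
                       (k-max (cut (arc H) c′) ∧-⊆ (cut-bipartite (arc H) c′))
      S⊆kept₀ : S ⊆ᵃ kept K₂ φ₀
      S⊆kept₀ u v uv rewrite side-vertex (c u) | side-vertex (c v) | S⊆H u v uv = ≢⇒xor-true (c-splits u v uv)
      k≤kept₀ : k ≤ #arcs (kept K₂ φ₀)
      k≤kept₀ = subst (_≤ #arcs (kept K₂ φ₀)) (trans (sym (count≡#arcs _ S)) #S) (#arcs-mono S⊆kept₀)
      kept≤kept₀ : ∀ ψ → #arcs (kept K₂ ψ) ≤ #arcs (kept K₂ φ₀)
      kept≤kept₀ ψ = ℕP.≤-trans (cut≤k (side ∘ proj₁ ∘ ψ)) k≤kept₀
      d₀-min : ∀ ψ → Injective _≡_ _≡_ ψ → d₀ ≤ missing H K₂ ψ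
      d₀-min ψ _ = ℕP.+-cancelˡ-≤ (#arcs (kept K₂ φ₀)) d₀ (missing H K₂ ψ) (begin
        #arcs (kept K₂ φ₀) + d₀              ≡⟨ sym (arcCount≡kept+missing K₂ φ₀) ⟩
        e                                    ≡⟨ arcCount≡kept+missing K₂ ψ ⟩
        #arcs (kept K₂ ψ) + missing H K₂ ψ   ≤⟨ ℕP.+-monoˡ-≤ (missing H K₂ ψ) (kept≤kept₀ ψ) ⟩
        #arcs (kept K₂ φ₀) + missing H K₂ ψ  ∎)
      e≤d₀+k : e ≤ d₀ + k
      e≤d₀+k = begin
        e                        ≡⟨ arcCount≡kept+missing K₂ φ₀ ⟩
        #arcs (kept K₂ φ₀) + d₀  ≤⟨ ℕP.+-monoˡ-≤ d₀ (cut≤k (side ∘ vertex ∘ c)) ⟩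
        k + d₀                   ≡⟨ ℕP.+-comm k d₀ ⟩
        d₀ + k                   ∎
      c-max : Vector Bool (size H)
      c-max = proj₁ (maxCut (arc H) (loopless H))
      e≤k+k : e ≤ k + k
      e≤k+k = begin
        e                                                    ≡⟨ count≡#arcs _ (arc H) ⟩
        #arcs (arc H)                                        ≤⟨ proj₂ (maxCut (arc H) (loopless H)) ⟩
        #arcs (cut (arc H) c-max) + #arcs (cut (arc H) c-max) ≤⟨ ℕP.+-mono-≤ (cut≤k c-max) (cut≤k c-max) ⟩
        k + k                                                ∎
      -- K₂ has 2 arcs on 4 ordered pairs.
      e*2*s≤ : e * 2 * suc q ≤ (k * suc q + 1) * 4
      e*2*s≤ = begin
        e * 2 * suc q        ≤⟨ ℕP.*-monoˡ-≤ (suc q) (ℕP.*-monoˡ-≤ 2 e≤k+k) ⟩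
        (k + k) * 2 * suc q  ≡⟨ solve 2 (λ k s → (k :+ k) :* con 2 :* s := k :* s :* con 4) refl k (suc q) ⟩
        k * suc q * 4        ≤⟨ ℕP.*-monoˡ-≤ 4 (ℕP.m≤m+n (k * suc q) 1) ⟩
        (k * suc q + 1) * 4  ∎
        where open +-*-Solver

    backward-descends : ∀ u v → arc H u v ∧ not (precedes u v) ≡ true → toℕ v < toℕ u
    backward-descends u v uv∧¬u<v with ∧-true⁻ uv∧¬u<v
    ... | uv , ¬u<v = ℕP.≤∧≢⇒< (<ᵇ-false⇒≥ (not-injective ¬u<v)) v≢u
      where
      v≢u : toℕ v ≢ toℕ u
      v≢u eq with () ← trans (sym (loopless H u)) (subst (λ w → arc H u w ≡ true) (FinP.toℕ-injective eq) uv)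

    acyclic≤γ : ∀ {g} → IsGamma H g → ∀ K → K ⊆ᵃ arc H → Acyclic K → #arcs K ≤ g
    acyclic≤γ {g} (_ , g-max) K K⊆H K-acyclic = subst (_≤ g) (count≡#arcs _ K) (g-max K K⊆H K-acyclic)

    arcCount≤2γ : ∀ g → IsGamma H g → arcCount H ≤ g + g
    arcCount≤2γ g γ = begin
      arcCount H                      ≡⟨ count≡#arcs _ (arc H) ⟩
      #arcs (arc H)                   ≡⟨ #arcs-split (arc H) precedes ⟩
      #arcs forward + #arcs backward  ≤⟨ ℕP.+-mono-≤ (acyclic≤γ γ forward ∧-⊆ (ascending-acyclic (λ u → u) (arc H)))
                                                     (acyclic≤γ γ backward ∧-⊆ backward-acyclic) ⟩
      g + g                           ∎
      where
      open ℕP.≤-Reasoning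
      forward backward : Arcs (size H)
      forward u v = arc H u v ∧ precedes u v
      backward u v = arc H u v ∧ not (precedes u v)
      backward-acyclic : Acyclic backward
      backward-acyclic = acyclic-by-rank (flip ℕP.<-trans) (λ eq → ℕP.<-irrefl (sym eq)) toℕ backward backward-descends

    gamma-upper : ∀ g → IsGamma H g → ∀ q → f≤ (ℕtoℚ g ℚ.+ ℤ.+ 1 / suc q)
    gamma-upper g γ q =
      T , d₀ , (0F , sucF 0F , refl) , ((place T σ₀ , place-injective T σ₀ , refl) , λ ψ _ → σ₀-min (proj₁ ∘ ψ)) ,
      upper-bound T d₀ g q (complement≤ e g E (E + N) q E+[E+N]≡N² density-bound) e≤d₀+g
      where
      open ℕP.≤-Reasoning
      e : ℕ
      e = arcCount H
      N : ℕ
      N = suc (suc (e * suc q))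
      T : Digraph
      T = tournament N
      E : ℕ
      E = arcCount T
      -- The arcs lost by a copy ψ depend only on its parts proj₁ ∘ ψ, so disc_H(T) is a minimum
      -- over the finitely many part assignments.
      F : Vector (Fin N) (size H) → ℕ
      F σ = missing H T (place T σ)
      F-cong : ∀ {σ τ} → σ ≗ τ → F σ ≡ F τ
      F-cong {σ} {τ} σ≗τ = trans (missing≡#lost T (place T σ)) (trans
        (#arcs-cong (λ u v → cong₂ (λ a b → arc H u v ∧ not (precedes a b)) (σ≗τ u) (σ≗τ v)))
        (sym (missing≡#lost T (place T τ))))
      σ₀ : Vector (Fin N) (size H)
      σ₀-min : ∀ τ → F σ₀ ≤ F τ
      σ₀ = proj₁ (Vector-argmin (size H) F F-cong)
      σ₀-min = proj₂ (Vector-argmin (size H) F F-cong)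
      d₀ : ℕ
      d₀ = F σ₀
      kept≤g : #arcs (kept T (place T σ₀)) ≤ g
      kept≤g = acyclic≤γ γ (kept T (place T σ₀)) ∧-⊆ (ascending-acyclic σ₀ (arc H))
      e≤d₀+g : e ≤ d₀ + g
      e≤d₀+g = begin
        e                                 ≡⟨ arcCount≡kept+missing T (place T σ₀) ⟩
        #arcs (kept T (place T σ₀)) + d₀  ≤⟨ ℕP.+-monoˡ-≤ d₀ kept≤g ⟩
        g + d₀                            ≡⟨ ℕP.+-comm g d₀ ⟩
        d₀ + g                            ∎
      2E+N≡N² : E + E + N ≡ N * N
      2E+N≡N² = trans (cong (λ x → x + x + N) (count≡#arcs N precedes)) (#arcs-precedes N)
      E+[E+N]≡N² : E + (E + N) ≡ N * N
      E+[E+N]≡N² = trans (sym (ℕP.+-assoc E E N)) 2E+N≡N²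
      e*s≤N : e * suc q ≤ N
      e*s≤N = ℕP.≤-trans (ℕP.n≤1+n _) (ℕP.n≤1+n _)
      density-bound : e * (E + N) * suc q ≤ (g * suc q + 1) * (N * N)
      density-bound = tournament-arith e g (suc q) E N 2E+N≡N² (arcCount≤2γ g γ) e*s≤N

open import Defs
open import Data.Nat using (ℕ; suc; _≤_)
open import Data.Product using (_×_; _,_; ∃-syntax)
open import Data.Integer using (+_)
open import Data.Rational using (ℚ; Positive; _/_; _+_) renaming (_≤_ to _≤ℚ_)
import Data.Rational.Properties as ℚP
open Fractions using (1/suc≤pos)
open Bounds using (lower-bound; f≤-mono; gamma-upper; bip-upper)

lemma3p2 : (H : Digraph) → 2 ≤ arcCount H →
  ((L : Digraph) → HasArc L → (d : ℕ) → IsDisc H L d →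
     (+ arcCount H / 2) ≤ℚ fHL H L d)
  ×
  ((g k : ℕ) → IsGamma H g → IsBip H k → (ε : ℚ) → Positive ε →
     (∃[ L ] ∃[ d ] (HasArc L × IsDisc H L d × fHL H L d ≤ℚ (ℕtoℚ g + ε)))
     ×
     (∃[ L ] ∃[ d ] (HasArc L × IsDisc H L d × fHL H L d ≤ℚ (ℕtoℚ k + ε))))
lemma3p2 H _ = lower-bound H , λ g k γ b ε ε>0 →
  let q , 1/q≤ε = 1/suc≤pos ε ε>0
      slack : ∀ x → ℕtoℚ x + + 1 / suc q ≤ℚ ℕtoℚ x + ε
      slack x = ℚP.+-monoʳ-≤ (ℕtoℚ x) 1/q≤ε
  in f≤-mono H (slack g) (gamma-upper H g γ q) , f≤-mono H (slack k) (bip-upper H k b q)
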